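{- $\mathcal{T}_{E_T^\infty}(T_{\check\Box})\leftrightarrow_b^\Delta\mathcal{T}_{E_T\cup E_Q}\big([H_\Box\parallel[Q^{il}_o\parallel(1+o!\bot.Q^{lo}_i)]_{\{l\}}]_{\{i,o\}}\big)$.
   Context: Process calculus. Fix a finite set $\mathcal{A}$ of actions, $\tau\notin\mathcal{A}$, a finite data set $\mathcal{D}$ with blank $\Box\notin\mathcal{D}$, $\mathcal{D}_\Box=\mathcal{D}\cup\{\Box\}$, extra symbols $\bot,\$\notin\mathcal{D}_\Box$, and channels including $i,o,l,r,w,m$. For a set $C'$ of channels, $I_{C'}=\{c?v,c!v\mid c\in C'\}$, $v$ ranging over communicated values (including $\mathcal{D}_\Box$, $L$, $R$, $\bot$, $\$$). Process expressions: $p::=0\mid 1\mid a.p\mid p+p\mid[p\parallel p]_{C'}\mid X$. A recursive specification $E$ is a set of equations $X\stackrel{def}{=}p$, at most one per name, with defining equations for all names used. Rules ($p\downarrow$ = termination): $1\downarrow$; $a.p\xrightarrow{a}p$; $p+q$ has the transitions of $p$ and $q$ and terminates if either does; $[p\parallel q]_{C'}\xrightarrow{a}[p'\parallel q]_{C'}$ if $p\xrightarrow{a}p'$, $a\notin I_{C'}$, and symmetrically; $[p\parallel q]_{C'}\xrightarrow{\tau}[p'\parallel q']_{C'}$ if for some $c\in C'$ and $v$, $p\xrightarrow{c?v}p'$, $q\xrightarrow{c!v}q'$ or vice versa; $[p\parallel q]_{C'}\downarrow$ iff both terminate; names behave as their defining right-hand sides. $\mathcal{T}_E(p)$: expressions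 reachable from $p$, initial $p$, final those $q$ with $q\downarrow$. Tape instances: finite sequences over $\mathcal{D}_\Box$ and marked symbols $\check d$ with exactly one marked symbol, identified modulo blanks at the ends; $\overleftarrow{\delta}$ (resp. $\overrightarrow{\delta}$) marks the rightmost (resp. leftmost) symbol of $\delta\in\mathcal{D}_\Box^*$, or is $\check\Box$ if $\delta$ is empty. $E_T^\infty$: $T_{\delta_L\check d\delta_R}\stackrel{def}{=}r!d.T_{\delta_L\check d\delta_R}+\sum_{e\in\mathcal{D}_\Box}w?e.T_{\delta_L\check e\delta_R}+m?L.T_{\overleftarrow{\delta_L}d\delta_R}+m?R.T_{\delta_Ld\overrightarrow{\delta_R}}+1$ for all $d,\delta_L,\delta_R$. Finite queue $E_Q$ (over $\Delta=\mathcal{D}_\Box\cup\{\bot,\$\}$): for every $\{j,k,p\}=\{i,o,l\}$: $Q^{jk}_p\stackrel{def}{=}\sum_{x\in\Delta}j?x.[Q^{jp}_k\parallel(1+k!x.Q^{pk}_j)]_{\{p\}}+1$. Controller $E_T$: $H_d\stackrel{def}{=}r!d.H_d+\sum_{e\in\mathcal{D}_\Box}w?e.H_e+m?L.H^L_d+m?R.H^R_d+1$; $H^L_d\stackrel{def}{=}i!d.(\sum_{e\in\mathcal{D}_\Box}o?e.H_e+o?\bot.i!\$.i!\bot.\mathit{Back})$; $\mathit{Back}\stackrel{def}{=}\sum_{e\in\mathcal{D}_\Box}o?e.i!e.\mathit{Back}+o?\$.H_\Box$; $H^R_d\stackrel{def}{=}i!\$.i!d.(\sum_{e\in\mathcal{D}_\Box}o?e.\mathit{Fwd}_e+o?\bot.\mathit{Fwd}_\bot)$;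 $\mathit{Fwd}_d\stackrel{def}{=}\sum_{e\in\mathcal{D}_\Box}o?e.i!d.\mathit{Fwd}_e+o?\bot.i!d.\mathit{Fwd}_\bot+o?\$.H_d$; $\mathit{Fwd}_\bot\stackrel{def}{=}\sum_{e\in\mathcal{D}_\Box}o?e.i!\bot.\mathit{Fwd}_e+o?\$.i!\bot.H_\Box$. Divergence-preserving branching bisimilarity $\leftrightarrow_b^\Delta$: write $s\xrightarrow{(a)}t$ if $s\xrightarrow{a}t$ or ($a=\tau$ and $s=t$); $\twoheadrightarrow$ / $\twoheadrightarrow^+$ are reflexive-transitive / transitive closures of $\xrightarrow{\tau}$. A relation $\mathcal{R}$ is a divergence-preserving branching bisimulation if $s_1\mathcal{R}s_2$ implies: (1) $s_1\xrightarrow{a}s_1'$ gives $s_2\twoheadrightarrow s_2''\xrightarrow{(a)}s_2'$ with $s_1\mathcal{R}s_2''$, $s_1'\mathcal{R}s_2'$; (2) symmetrically; (3) if $s_1$ final then $s_2\twoheadrightarrow s_2'$ final with $s_1\mathcal{R}s_2'$; (4) symmetrically; (5) an infinite $\tau$-sequence from $s_1$ with all states related to $s_2$ gives $s_2\twoheadrightarrow^+s_2'$ with $s_2'$ related to some state of the sequence; (6) symmetrically. Two transition systems are $\leftrightarrow_b^\Delta$ if such a relation relates their initial states. -}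

module Defs where

open import Data.Nat using (ℕ; zero; suc)
open import Data.Fin using (Fin)
open import Data.Maybe using (Maybe; just; nothing)
open import Data.Bool using (Bool; true; false)
open import Data.List using (List; []; _∷_; map; allFin; reverse; dropWhile)
open import Data.List.Membership.Propositional using (_∈_)
open import Data.Product using (Σ; ∃; _×_; _,_)
open import Data.Sum using (_⊎_; inj₁; inj₂)
open import Relation.Binary.PropositionalEquality using (_≡_)
open import Relation.Nullary using (¬_; Dec; yes; no)

data Chan : Set where
  ci co cl cr cw cm : Chan

record LTS (Lab : Set) : Set₁ where
  field
    State : Set
    _⟶[_]_ : State → Lab → State → Set
    Final : State → Set
    init : State

module Bisim {Lab : Set} (τl : Lab) where

  module _ (T : LTS Lab) where
    open LTS T
    data _↠_ : State → State → Set where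
      ↠refl : ∀ {s} → s ↠ s
      ↠step : ∀ {s t u} → s ⟶[ τl ] t → t ↠ u → s ↠ u
    data _↠⁺_ : State → State → Set where
      ↠⁺step : ∀ {s t u} → s ⟶[ τl ] t → t ↠ u → s ↠⁺ u
    _⟶⟨_⟩_ : State → Lab → State → Set
    s ⟶⟨ a ⟩ t = (s ⟶[ a ] t) ⊎ ((a ≡ τl) × (s ≡ t))

  -- one half (clauses (1), (3), (5)) of the definition; the other half
  -- (clauses (2), (4), (6)) is the same with the roles swapped
  record Half (T₁ T₂ : LTS Lab) (R : LTS.State T₁ → LTS.State T₂ → Set) : Set where
    open LTS T₁ renaming (State to S₁; _⟶[_]_ to _⟶₁[_]_; Final to Final₁)
    open LTS T₂ renaming (State to S₂; _⟶[_]_ to _⟶₂[_]_; Final to Final₂)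
    field
      step : ∀ {s₁ s₂} → R s₁ s₂ → ∀ {a s₁'} → s₁ ⟶₁[ a ] s₁' →
             Σ S₂ λ s₂'' → Σ S₂ λ s₂' →
               (_↠_ T₂ s₂ s₂'') × _⟶⟨_⟩_ T₂ s₂'' a s₂' × R s₁ s₂'' × R s₁' s₂'
      final : ∀ {s₁ s₂} → R s₁ s₂ → Final₁ s₁ →
              Σ S₂ λ s₂' → (_↠_ T₂ s₂ s₂') × Final₂ s₂' × R s₁ s₂'
      divergence : ∀ {s₁ s₂} → R s₁ s₂ → (f : ℕ → S₁) → f zero ≡ s₁ →
                   (∀ k → f k ⟶₁[ τl ] f (suc k)) → (∀ k → R (f k) s₂) →
                   Σ S₂ λ s₂' → (_↠⁺_ T₂ s₂ s₂') × Σ ℕ λ k → R (f k) s₂'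

  record IsDivBranchingBisim (T₁ T₂ : LTS Lab) (R : LTS.State T₁ → LTS.State T₂ → Set) : Set where
    field
      forth : Half T₁ T₂ R
      back  : Half T₂ T₁ (λ s₂ s₁ → R s₁ s₂)

  _↔bΔ_ : LTS Lab → LTS Lab → Set₁
  T₁ ↔bΔ T₂ = Σ (LTS.State T₁ → LTS.State T₂ → Set) λ R →
                IsDivBranchingBisim T₁ T₂ R × R (LTS.init T₁) (LTS.init T₂)

-- The process calculus, for nA actions (𝒜 = Fin nA) and n data (𝒟 = Fin n)

module Calculus (nA n : ℕ) where

  -- 𝒟□ : nothing is the blank □
  D□ : Set
  D□ = Maybe (Fin n)

  all𝒟□ : List D□
  all𝒟□ = nothing ∷ map just (allFin n)

  data Val : Set where
    dv : D□ → Val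
    vL vR v⊥ v$ : Val

  data Label : Set where
    act : Fin nA → Label
    τ : Label
    _¿_ : Chan → Val → Label
    _‼_ : Chan → Val → Label

  data InI (C : List Chan) : Label → Set where
    inRecv : ∀ {c v} → c ∈ C → InI C (c ¿ v)
    inSend : ∀ {c v} → c ∈ C → InI C (c ‼ v)

  infixr 6 _⊕_
  infixr 7 _∙_
  data Proc (N : Set) : Set where
    𝟘 𝟙 : Proc N
    _∙_ : Label → Proc N → Proc N
    _⊕_ : Proc N → Proc N → Proc N
    par : Proc N → List Chan → Proc N → Proc N
    var : N → Proc N

  -- a recursive specification: exactly one defining equation per name
  Spec : Set → Set
  Spec N = N → Proc N

  module _ {N : Set} (E : Spec N) where
    data _⟶[_]_ : Proc N → Label → Proc N → Set where
      pre   : ∀ {a p} → (a ∙ p) ⟶[ a ] p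
      sumL  : ∀ {p q a p'} → p ⟶[ a ] p' → (p ⊕ q) ⟶[ a ] p'
      sumR  : ∀ {p q a q'} → q ⟶[ a ] q' → (p ⊕ q) ⟶[ a ] q'
      parL  : ∀ {p q C a p'} → p ⟶[ a ] p' → ¬ InI C a → par p C q ⟶[ a ] par p' C q
      parR  : ∀ {p q C a q'} → q ⟶[ a ] q' → ¬ InI C a → par p C q ⟶[ a ] par p C q'
      commL : ∀ {p q C c v p' q'} → c ∈ C → p ⟶[ c ¿ v ] p' → q ⟶[ c ‼ v ] q' →
              par p C q ⟶[ τ ] par p' C q'
      commR : ∀ {p q C c v p' q'} → c ∈ C → p ⟶[ c ‼ v ] p' → q ⟶[ c ¿ v ] q' →
              par p C q ⟶[ τ ] par p' C q'
      rec   : ∀ {X a p'} → E X ⟶[ a ] p' → var X ⟶[ a ] p'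

    data _↓ : Proc N → Set where
      one  : 𝟙 ↓
      sumL : ∀ {p q} → p ↓ → (p ⊕ q) ↓
      sumR : ∀ {p q} → q ↓ → (p ⊕ q) ↓
      par↓ : ∀ {p q C} → p ↓ → q ↓ → par p C q ↓
      rec  : ∀ {X} → E X ↓ → var X ↓

    data Reach (p : Proc N) : Proc N → Set where
      here : Reach p p
      there : ∀ {q a q'} → Reach p q → q ⟶[ a ] q' → Reach p q'

    𝒯 : Proc N → LTS Label
    𝒯 p = record
      { State = Σ (Proc N) (Reach p)
      ; _⟶[_]_ = λ { (q , _) a (q' , _) → q ⟶[ a ] q' }
      ; Final = λ { (q , _) → q ↓ }
      ; init = (p , here) }

  open Bisim τ public

  sumNE : ∀ {N} → Proc N → List (Proc N) → Proc N
  sumNE p [] = p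
  sumNE p (q ∷ qs) = p ⊕ sumNE q qs

  Σ𝒟□ : ∀ {N} → (D□ → Proc N) → Proc N
  Σ𝒟□ f = sumNE (f nothing) (map f (map just (allFin n)))

  ΣΔ : ∀ {N} → (Val → Proc N) → Proc N
  ΣΔ f = sumNE (f v⊥) (f v$ ∷ map (λ e → f (dv e)) all𝒟□)

  -- Tape instances: (δL , d , δR) stands for δL ď δR, where δL is stored
  -- reversed (nearest symbol first). Identification modulo blanks at
  -- the ends is realised by the normal form `norm` (drop far blanks).

  Tape : Set
  Tape = List D□ × D□ × List D□

  isBlank : (d : D□) → Dec (d ≡ nothing)
  isBlank nothing = yes Relation.Binary.PropositionalEquality.refl
  isBlank (just _) = no λ ()

  dropFarBlanks : List D□ → List D□
  dropFarBlanks xs = reverse (dropWhile isBlank (reverse xs))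

  norm : Tape → Tape
  norm (L , d , R) = (dropFarBlanks L , d , dropFarBlanks R)

  moveL : Tape → Tape
  moveL ([] , d , R) = ([] , nothing , d ∷ R)
  moveL (e ∷ L , d , R) = (L , e , d ∷ R)

  moveR : Tape → Tape
  moveR (L , d , []) = (d ∷ L , nothing , [])
  moveR (L , d , e ∷ R) = (d ∷ L , e , R)

  T : Tape → Proc Tape
  T t = var (norm t)

  E∞ : Spec Tape
  E∞ (L , d , R) =
      (cr ‼ dv d) ∙ T (L , d , R)
    ⊕ Σ𝒟□ (λ e → (cw ¿ dv e) ∙ T (L , e , R))
    ⊕ (cm ¿ vL) ∙ T (moveL (L , d , R))
    ⊕ (cm ¿ vR) ∙ T (moveR (L , d , R))
    ⊕ 𝟙

  T□ : Proc Tape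
  T□ = T ([] , nothing , [])

  -- Queue names Q^{jk}_p for {j,k,p} = {i,o,l}; constructor names list j k p

  data QName : Set where
    Qilo Qiol Qlio Qloi Qoil Qoli : QName

  chans : QName → Chan × Chan × Chan
  chans Qilo = (ci , cl , co)
  chans Qiol = (ci , co , cl)
  chans Qlio = (cl , ci , co)
  chans Qloi = (cl , co , ci)
  chans Qoil = (co , ci , cl)
  chans Qoli = (co , cl , ci)

  -- Q^{jk}_p ↦ Q^{jp}_k
  sh₁ : QName → QName
  sh₁ Qilo = Qiol
  sh₁ Qiol = Qilo
  sh₁ Qlio = Qloi
  sh₁ Qloi = Qlio
  sh₁ Qoil = Qoli
  sh₁ Qoli = Qoil

  -- Q^{jk}_p ↦ Q^{pk}_j
  sh₂ : QName → QName
  sh₂ Qilo = Qoli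
  sh₂ Qiol = Qloi
  sh₂ Qlio = Qoil
  sh₂ Qloi = Qiol
  sh₂ Qoil = Qlio
  sh₂ Qoli = Qilo

  data HName : Set where
    H HL HR Fwd : D□ → HName
    Back Fwd⊥ : HName

  Name : Set
  Name = HName ⊎ QName

  h : HName → Proc Name
  h x = var (inj₁ x)

  q : QName → Proc Name
  q x = var (inj₂ x)

  ETQ : Spec Name
  ETQ (inj₂ X) with chans X
  ... | (j , k , p) =
    ΣΔ (λ x → (j ¿ x) ∙ par (q (sh₁ X)) (p ∷ []) (𝟙 ⊕ (k ‼ x) ∙ q (sh₂ X))) ⊕ 𝟙
  ETQ (inj₁ (H d)) =
      (cr ‼ dv d) ∙ h (H d)
    ⊕ Σ𝒟□ (λ e → (cw ¿ dv e) ∙ h (H e))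
    ⊕ (cm ¿ vL) ∙ h (HL d)
    ⊕ (cm ¿ vR) ∙ h (HR d)
    ⊕ 𝟙
  ETQ (inj₁ (HL d)) =
    (ci ‼ dv d) ∙ ( Σ𝒟□ (λ e → (co ¿ dv e) ∙ h (H e))
                  ⊕ (co ¿ v⊥) ∙ (ci ‼ v$) ∙ (ci ‼ v⊥) ∙ h Back)
  ETQ (inj₁ Back) =
    Σ𝒟□ (λ e → (co ¿ dv e) ∙ (ci ‼ dv e) ∙ h Back) ⊕ (co ¿ v$) ∙ h (H nothing)
  ETQ (inj₁ (HR d)) =
    (ci ‼ v$) ∙ (ci ‼ dv d) ∙ ( Σ𝒟□ (λ e → (co ¿ dv e) ∙ h (Fwd e))
                              ⊕ (co ¿ v⊥) ∙ h Fwd⊥)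
  ETQ (inj₁ (Fwd d)) =
      Σ𝒟□ (λ e → (co ¿ dv e) ∙ (ci ‼ dv d) ∙ h (Fwd e))
    ⊕ (co ¿ v⊥) ∙ (ci ‼ dv d) ∙ h Fwd⊥
    ⊕ (co ¿ v$) ∙ h (H d)
  ETQ (inj₁ Fwd⊥) =
      Σ𝒟□ (λ e → (co ¿ dv e) ∙ (ci ‼ v⊥) ∙ h (Fwd e))
    ⊕ (co ¿ v$) ∙ (ci ‼ v⊥) ∙ h (H nothing)

  System : Proc Name
  System = par (h (H nothing)) (ci ∷ co ∷ [])
               (par (q Qilo) (cl ∷ []) (𝟙 ⊕ (co ‼ v⊥) ∙ q Qloi))

module Submission where

open import Data.Nat using (ℕ; zero; suc; _+_; _<_; z≤n; s≤s; s≤s⁻¹)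
open import Data.Nat.Properties using (+-suc; +-identityʳ; +-comm; m<n+m; <-≤-trans; n<1+n)
open import Data.Maybe using (just; nothing)
open import Data.List using (List; []; _∷_; map; _++_; length; reverse; dropWhile)
open import Data.List.Properties using (++-assoc; ++-identityʳ; length-++; reverse-++; unfold-reverse; length-reverse; map-++; map-∘; ∷-injective; ∷ʳ-injective)
open import Data.List.Relation.Unary.Any using (Any; here; there; satisfied)
open import Data.List.Relation.Unary.Any.Properties using (map⁺; map⁻)
open import Data.List.Membership.Propositional using (_∈_; lose)
open import Data.List.Membership.Propositional.Properties using (∈-allFin; ∈-map⁺)
open import Data.Product using (Σ; _×_; _,_; proj₁; proj₂)
open import Data.Sum using (inj₁; inj₂)
open import Data.Empty using (⊥; ⊥-elim)
open import Relation.Binary.PropositionalEquality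
open import Relation.Binary.Construct.Closure.ReflexiveTransitive using (Star; ε; _◅_; _◅◅_; gmap)
open import Relation.Nullary using (¬_)
open import Induction.WellFounded using (Acc; acc)
open import Defs

-- The witness is `Sim`: it relates T_t to [c ∥ Q]_{i,o} when Q, unfolded
-- from Q^{io}_l, is a FIFO queue holding cs, and the controller c is in a
-- phase for t expecting cs: either home in H_d with the queue holding the
-- rest of the tape (the encoding `enc t`), or in transit, rotating the
-- queue to carry out a head move.

module SumSteps (nA n : ℕ) where
  open Calculus nA n

  data IsΔ : Val → Set where
    isD : ∀ e → IsΔ (dv e)
    is⊥ : IsΔ v⊥
    is$ : IsΔ v$

  ∈-all𝒟□ : ∀ e → e ∈ all𝒟□
  ∈-all𝒟□ nothing = here refl
  ∈-all𝒟□ (just i) = there (∈-map⁺ just (∈-allFin i))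

  module _ {N : Set} {E : Spec N} where
    private
      _⟶⟪_⟫_ : Proc N → Label → Proc N → Set
      _⟶⟪_⟫_ = _⟶[_]_ E

      ΣΔ-rest : (Val → Proc N) → List (Proc N)
      ΣΔ-rest f = f v$ ∷ map (λ e → f (dv e)) all𝒟□

    sumNE-inv : ∀ {p ps a p'} → sumNE p ps ⟶⟪ a ⟫ p' → Any (λ r → r ⟶⟪ a ⟫ p') (p ∷ ps)
    sumNE-inv {ps = []} s = here s
    sumNE-inv {ps = _ ∷ _} (sumL s) = here s
    sumNE-inv {ps = _ ∷ _} (sumR s) = there (sumNE-inv s)

    sumNE-intro : ∀ {p ps a p'} → Any (λ r → r ⟶⟪ a ⟫ p') (p ∷ ps) → sumNE p ps ⟶⟪ a ⟫ p'
    sumNE-intro {ps = []} (here s) = s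
    sumNE-intro {ps = _ ∷ _} (here s) = sumL s
    sumNE-intro {ps = _ ∷ _} (there s) = sumR (sumNE-intro s)

    Σ𝒟□-inv : ∀ (f : D□ → Proc N) {a p'} → Σ𝒟□ f ⟶⟪ a ⟫ p' → Σ D□ λ e → f e ⟶⟪ a ⟫ p'
    Σ𝒟□-inv f s = satisfied (map⁻ (sumNE-inv s))

    Σ𝒟□-intro : ∀ (f : D□ → Proc N) {a p'} e → f e ⟶⟪ a ⟫ p' → Σ𝒟□ f ⟶⟪ a ⟫ p'
    Σ𝒟□-intro f e s = sumNE-intro (map⁺ (lose (∈-all𝒟□ e) s))

    ΣΔ-inv : ∀ (f : Val → Proc N) {a p'} → ΣΔ f ⟶⟪ a ⟫ p' → Σ Val λ x → IsΔ x × f x ⟶⟪ a ⟫ p'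
    ΣΔ-inv f s with sumNE-inv {ps = ΣΔ-rest f} s
    ... | here s' = v⊥ , is⊥ , s'
    ... | there (here s') = v$ , is$ , s'
    ... | there (there s') with satisfied (map⁻ s')
    ...   | e , s'' = dv e , isD e , s''

    ΣΔ-intro : ∀ (f : Val → Proc N) {a p' x} → IsΔ x → f x ⟶⟪ a ⟫ p' → ΣΔ f ⟶⟪ a ⟫ p'
    ΣΔ-intro f is⊥ s = sumNE-intro {ps = ΣΔ-rest f} (here s)
    ΣΔ-intro f is$ s = sumNE-intro {ps = ΣΔ-rest f} (there (here s))
    ΣΔ-intro f (isD e) s =
      sumNE-intro {ps = ΣΔ-rest f} (there (there (map⁺ (lose (∈-all𝒟□ e) s))))

module Runs (nA n : ℕ) where
  open Calculus nA n

  module _ {N : Set} (E : Spec N) where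
    _⇐τ_ : Proc N → Proc N → Set
    p' ⇐τ p = _⟶[_]_ E p τ p'

    lift-run : ∀ {root p p'} → Star (λ x y → _⟶[_]_ E x τ y) p p' → (r : Reach E root p) →
               Σ (Reach E root p') λ r' → _↠_ (𝒯 E root) (p , r) (p' , r')
    lift-run ε r = r , ↠refl
    lift-run (s ◅ run) r with lift-run run (there r s)
    ... | r' , run' = r' , ↠step s run'

    no-infinite-run : ∀ {p} → Acc _⇐τ_ p → (g : ℕ → Proc N) → g 0 ≡ p →
                      (∀ i → _⟶[_]_ E (g i) τ (g (suc i))) → ⊥
    no-infinite-run (acc rs) g refl run = no-infinite-run (rs (run 0)) (λ i → g (suc i)) refl (λ i → run (suc i))

-- The queue E_Q.  `Queue X P cs` says that P arises from the name Q^{jk}_p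
-- (X = Q^{jk}_p) by unfolding and holds the contents cs, front first.
module Queues (nA n : ℕ) where
  open Calculus nA n
  open SumSteps nA n

  _⇒[_]_ : Proc Name → Label → Proc Name → Set
  _⇒[_]_ = _⟶[_]_ ETQ

  _⇒τ*_ : Proc Name → Proc Name → Set
  _⇒τ*_ = Star (λ p p' → p ⇒[ τ ] p')

  τ∉I : ∀ {C} → ¬ InI C τ
  τ∉I ()

  on¿ : ∀ {c c' v P P'} → c ≡ c' → P ⇒[ c ¿ v ] P' → P ⇒[ c' ¿ v ] P'
  on¿ refl s = s

  on‼ : ∀ {c c' v P P'} → c ≡ c' → P ⇒[ c ‼ v ] P' → P ⇒[ c' ‼ v ] P'
  on‼ refl s = s

  -- for X = Q^{jk}_p: the input channel j, the output channel k, the link p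
  jc kc pc : QName → Chan
  jc X = proj₁ (chans X)
  kc X = proj₁ (proj₂ (chans X))
  pc X = proj₂ (proj₂ (chans X))

  -- how the channels of the two sub-queues Q^{jp}_k and Q^{pk}_j of Q^{jk}_p
  -- are connected: input from outside, output to the link, input from the
  -- link, output to outside
  sh₁-in : ∀ X → jc (sh₁ X) ≡ jc X
  sh₁-in Qilo = refl
  sh₁-in Qiol = refl
  sh₁-in Qlio = refl
  sh₁-in Qloi = refl
  sh₁-in Qoil = refl
  sh₁-in Qoli = refl

  sh₁-out : ∀ X → kc (sh₁ X) ≡ pc X
  sh₁-out Qilo = refl
  sh₁-out Qiol = refl
  sh₁-out Qlio = refl
  sh₁-out Qloi = refl
  sh₁-out Qoil = refl
  sh₁-out Qoli = refl

  sh₂-in : ∀ X → jc (sh₂ X) ≡ pc X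
  sh₂-in Qilo = refl
  sh₂-in Qiol = refl
  sh₂-in Qlio = refl
  sh₂-in Qloi = refl
  sh₂-in Qoil = refl
  sh₂-in Qoli = refl

  sh₂-out : ∀ X → kc (sh₂ X) ≡ kc X
  sh₂-out Qilo = refl
  sh₂-out Qiol = refl
  sh₂-out Qlio = refl
  sh₂-out Qloi = refl
  sh₂-out Qoil = refl
  sh₂-out Qoli = refl

  in≢link : ∀ X → jc X ≢ pc X
  in≢link Qilo ()
  in≢link Qiol ()
  in≢link Qlio ()
  in≢link Qloi ()
  in≢link Qoil ()
  in≢link Qoli ()

  out≢link : ∀ X → kc X ≢ pc X
  out≢link Qilo ()
  out≢link Qiol ()
  out≢link Qlio ()
  out≢link Qloi ()
  out≢link Qoil ()
  out≢link Qoli ()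

  input-visible : ∀ X {v} → ¬ InI (pc X ∷ []) (jc X ¿ v)
  input-visible X (inRecv (here e)) = in≢link X e

  output-visible : ∀ X {v} → ¬ InI (pc X ∷ []) (kc X ‼ v)
  output-visible X (inSend (here e)) = out≢link X e

  -- [A ∥ (1 + k!x.Q^{pk}_j)]_{p}: Q^{jk}_p holding x at its front, A behind it
  holding : QName → Proc Name → Val → Proc Name
  holding X A x = par A (pc X ∷ []) (𝟙 ⊕ (kc X ‼ x) ∙ q (sh₂ X))

  input-branch : QName → Val → Proc Name
  input-branch X x = (jc X ¿ x) ∙ holding X (q (sh₁ X)) x

  unfold-Q : ∀ X → ETQ (inj₂ X) ≡ ΣΔ (input-branch X) ⊕ 𝟙
  unfold-Q Qilo = refl
  unfold-Q Qiol = refl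
  unfold-Q Qlio = refl
  unfold-Q Qloi = refl
  unfold-Q Qoil = refl
  unfold-Q Qoli = refl

  empty-inv : ∀ {X a P'} → q X ⇒[ a ] P' →
              Σ Val λ x → IsΔ x × (a ≡ jc X ¿ x) × (P' ≡ holding X (q (sh₁ X)) x)
  empty-inv {X} {a} {P'} (rec s) with subst (λ r → r ⇒[ a ] P') (unfold-Q X) s
  ... | sumL s' with ΣΔ-inv (input-branch X) s'
  ...   | x , ix , pre = x , ix , refl , refl

  empty-input : ∀ {X x} → IsΔ x → q X ⇒[ jc X ¿ x ] holding X (q (sh₁ X)) x
  empty-input {X} {x} ix =
    rec (subst (λ r → r ⇒[ jc X ¿ x ] holding X (q (sh₁ X)) x) (sym (unfold-Q X))
               (sumL (ΣΔ-intro (input-branch X) ix pre)))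

  empty-final : ∀ {X} → _↓ ETQ (q X)
  empty-final {X} = rec (subst (_↓ ETQ) (sym (unfold-Q X)) (sumR one))

  data Queue : QName → Proc Name → List Val → Set where
    empty : ∀ {X} → Queue X (q X) []
    -- a value x waits in the output buffer of Q^{jk}_p
    cell  : ∀ {X A xs x} → IsΔ x → Queue (sh₁ X) A xs → Queue X (holding X A x) (x ∷ xs)
    -- the output buffer has become a queue Q^{pk}_j fed through the link
    link  : ∀ {X A B xs ys} → Queue (sh₁ X) A xs → Queue (sh₂ X) B ys →
            Queue X (par A (pc X ∷ []) B) (ys ++ xs)

  queue-final : ∀ {X P cs} → Queue X P cs → _↓ ETQ P
  queue-final empty = empty-final
  queue-final (cell _ Q) = par↓ (queue-final Q) (sumL one)
  queue-final (link QA QB) = par↓ (queue-final QA) (queue-final QB)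

  data QueueMove (X : QName) (cs : List Val) : Label → Proc Name → Set where
    input    : ∀ {c v P'} → c ≡ jc X → Queue X P' (cs ++ v ∷ []) → QueueMove X cs (c ¿ v) P'
    output   : ∀ {c v ys P'} → c ≡ kc X → cs ≡ v ∷ ys → Queue X P' ys → QueueMove X cs (c ‼ v) P'
    internal : ∀ {P'} → Queue X P' cs → QueueMove X cs τ P'

  queue-inv : ∀ {X P cs a P'} → Queue X P cs → P ⇒[ a ] P' → QueueMove X cs a P'
  queue-inv empty s with empty-inv s
  ... | x , ix , refl , refl = input refl (cell ix empty)
  queue-inv {X} (cell ix Q) (parL s ∉I) with queue-inv Q s
  ... | input e Q' = input (trans e (sh₁-in X)) (cell ix Q')
  ... | output e _ _ = ⊥-elim (∉I (inSend (here (trans e (sh₁-out X)))))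
  ... | internal Q' = internal (cell ix Q')
  queue-inv (cell ix Q) (parR (sumR pre) _) = output refl refl (link Q empty)
  queue-inv {X} (cell ix Q) (commL (here e) _ (sumR pre)) = ⊥-elim (out≢link X e)
  queue-inv (cell ix Q) (commR _ _ (sumR ()))
  queue-inv {X} (link {xs = xs} {ys} QA QB) (parL s ∉I) with queue-inv QA s
  ... | input {v = v} e QA' =
        input (trans e (sh₁-in X)) (subst (Queue X _) (sym (++-assoc ys xs (v ∷ []))) (link QA' QB))
  ... | output e _ _ = ⊥-elim (∉I (inSend (here (trans e (sh₁-out X)))))
  ... | internal QA' = internal (link QA' QB)
  queue-inv {X} (link QA QB) (parR s ∉I) with queue-inv QB s
  ... | input e _ = ⊥-elim (∉I (inRecv (here (trans e (sh₂-in X)))))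
  ... | output e refl QB' = output (trans e (sh₂-out X)) refl (link QA QB')
  ... | internal QB' = internal (link QA QB')
  queue-inv {X} (link QA QB) (commL (here e) s _) with queue-inv QA s
  ... | input e' _ = ⊥-elim (in≢link X (trans (sym (trans e' (sh₁-in X))) e))
  queue-inv {X} (link {ys = ys} QA QB) (commR (here e) s s') with queue-inv QA s | queue-inv QB s'
  ... | output {v = v} {ys = xs'} _ refl QA' | input _ QB' =
        internal (subst (Queue X _) (++-assoc ys (v ∷ []) xs') (link QA' QB'))

  run-left : ∀ {A A' C B} → A ⇒τ* A' → par A C B ⇒τ* par A' C B
  run-left = gmap _ (λ s → parL s τ∉I)

  run-right : ∀ {A C B B'} → B ⇒τ* B' → par A C B ⇒τ* par A C B'
  run-right = gmap _ (λ s → parR s τ∉I)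

  pass-over-link : ∀ X {A A₁ A' B B₀ B₁ v} →
                   A ⇒τ* A₁ → A₁ ⇒[ kc (sh₁ X) ‼ v ] A' → B ⇒[ jc (sh₂ X) ¿ v ] B₀ → B₀ ⇒τ* B₁ →
                   par A (pc X ∷ []) B ⇒τ* par A' (pc X ∷ []) B₁
  pass-over-link X τA oA iB τB =
    run-left τA ◅◅ commR (here refl) (on‼ (sh₁-out X) oA) (on¿ (sh₂-in X) iB) ◅ run-right τB

  queue-input : ∀ {X P cs v} → Queue X P cs → IsΔ v →
                Σ (Proc Name) λ P' → (P ⇒[ jc X ¿ v ] P') × Queue X P' (cs ++ v ∷ [])
  queue-input empty iv = _ , empty-input iv , cell iv empty
  queue-input {X} (cell ix Q) iv with queue-input Q iv
  ... | _ , s , Q' = _ , parL (on¿ (sh₁-in X) s) (input-visible X) , cell ix Q'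
  queue-input {X} {v = v} (link {xs = xs} {ys} QA QB) iv with queue-input QA iv
  ... | _ , s , QA' = _ , parL (on¿ (sh₁-in X) s) (input-visible X) ,
                      subst (Queue X _) (sym (++-assoc ys xs (v ∷ []))) (link QA' QB)

  queue-relay : ∀ {X B cs v} → Queue X B cs → cs ≡ [] → IsΔ v →
                Σ (Proc Name) λ B₀ → Σ (Proc Name) λ B₁ → Σ (Proc Name) λ B' →
                  (B ⇒[ jc X ¿ v ] B₀) × (B₀ ⇒τ* B₁) × (B₁ ⇒[ kc X ‼ v ] B') × Queue X B' []
  queue-relay {X} empty refl iv =
    _ , _ , _ , empty-input iv , ε , parR (sumR pre) (output-visible X) , link empty empty
  queue-relay {X} (link {xs = []} {[]} QA QB) refl iv with queue-relay QA refl iv | queue-relay QB refl iv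
  ... | _ , _ , _ , iA , τA , oA , QA' | _ , _ , _ , iB , τB , oB , QB' =
    _ , _ , _ , parL (on¿ (sh₁-in X) iA) (input-visible X) , pass-over-link X τA oA iB τB ,
    parR (on‼ (sh₂-out X) oB) (output-visible X) , link QA' QB'
  queue-relay (link {xs = _ ∷ _} {[]} _ _) () _
  queue-relay (link {ys = _ ∷ _} _ _) () _

  queue-output : ∀ {X P cs v rest} → Queue X P cs → cs ≡ v ∷ rest →
                 Σ (Proc Name) λ P₁ → Σ (Proc Name) λ P' →
                   (P ⇒τ* P₁) × (P₁ ⇒[ kc X ‼ v ] P') × Queue X P' rest × IsΔ v
  queue-output {X} (cell ix Q) refl = _ , _ , ε , parR (sumR pre) (output-visible X) , link Q empty , ix
  queue-output {X} (link {ys = _ ∷ _} QA QB) refl with queue-output QB refl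
  ... | _ , _ , τB , oB , QB' , iv =
    _ , _ , run-right τB , parR (on‼ (sh₂-out X) oB) (output-visible X) , link QA QB' , iv
  queue-output {X} (link {ys = []} QA QB) front with queue-output QA front
  ... | _ , _ , τA , oA , QA' , iv with queue-relay QB refl iv
  ...   | _ , _ , _ , iB , τB , oB , QB' =
    _ , _ , pass-over-link X τA oA iB τB , parR (on‼ (sh₂-out X) oB) (output-visible X) , link QA' QB' , iv

  -- `QueueAcc X b P`: every run of P consisting of τ-steps, outputs and at
  -- most b inputs is finite (inductively: all such successors are again
  -- accessible, an input consuming one unit of the budget b).  With b = 0
  -- it says that P has no infinite τ-run.
  data QueueAcc (X : QName) (b : ℕ) (P : Proc Name) : Set where
    qacc : (∀ {P'} → P ⇒[ τ ] P' → QueueAcc X b P') →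
           (∀ {v P'} → P ⇒[ kc X ‼ v ] P' → QueueAcc X b P') →
           (∀ {b' v P'} → b ≡ suc b' → P ⇒[ jc X ¿ v ] P' → QueueAcc X b' P') →
           QueueAcc X b P

  -- the back queue of Q^{jk}_p can only receive what the front queue sends,
  -- so its budget is that of Q^{jk}_p plus the contents of the front queue
  budget-shift : ∀ b (xs : List Val) v → suc b + length xs ≡ b + length (xs ++ v ∷ [])
  budget-shift b xs v = begin
    suc b + length xs         ≡⟨ sym (+-suc b (length xs)) ⟩
    b + suc (length xs)       ≡⟨ cong (b +_) (+-comm 1 (length xs)) ⟩
    b + (length xs + 1)       ≡⟨ cong (b +_) (sym (length-++ xs)) ⟩
    b + length (xs ++ v ∷ []) ∎
    where open ≡-Reasoning

  mutual
    linkAcc : ∀ {X b A B xs ys} → QueueAcc (sh₁ X) b A → QueueAcc (sh₂ X) (b + length xs) B →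
              Queue (sh₁ X) A xs → Queue (sh₂ X) B ys → QueueAcc X b (par A (pc X ∷ []) B)
    linkAcc accA accB QA QB =
      qacc (linkAcc-τ accA accB QA QB) (linkAcc-out accA accB QA QB) (linkAcc-in accA accB QA QB)

    linkAcc-τ : ∀ {X b A B xs ys P'} → QueueAcc (sh₁ X) b A → QueueAcc (sh₂ X) (b + length xs) B →
                Queue (sh₁ X) A xs → Queue (sh₂ X) B ys → par A (pc X ∷ []) B ⇒[ τ ] P' → QueueAcc X b P'
    linkAcc-τ (qacc τA _ _) accB QA QB (parL s _) with queue-inv QA s
    ... | internal QA' = linkAcc (τA s) accB QA' QB
    linkAcc-τ accA (qacc τB _ _) QA QB (parR s _) with queue-inv QB s
    ... | internal QB' = linkAcc accA (τB s) QA QB'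
    linkAcc-τ {X} _ _ QA QB (commL (here e) s _) with queue-inv QA s
    ... | input e' _ = ⊥-elim (in≢link X (trans (sym (trans e' (sh₁-in X))) e))
    linkAcc-τ {X} {b} (qacc _ oA _) (qacc _ _ iB) QA QB (commR (here e) s s')
      with queue-inv QA s | queue-inv QB s'
    ... | output {ys = xs'} e₁ refl QA' | input e₂ QB' =
      linkAcc (oA (on‼ e₁ s)) (iB (+-suc b (length xs')) (on¿ e₂ s')) QA' QB'

    linkAcc-out : ∀ {X b A B xs ys v P'} → QueueAcc (sh₁ X) b A → QueueAcc (sh₂ X) (b + length xs) B →
                  Queue (sh₁ X) A xs → Queue (sh₂ X) B ys → par A (pc X ∷ []) B ⇒[ kc X ‼ v ] P' →
                  QueueAcc X b P'
    linkAcc-out {X} _ _ QA QB (parL s _) with queue-inv QA s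
    ... | output e _ _ = ⊥-elim (out≢link X (trans e (sh₁-out X)))
    linkAcc-out {X} accA (qacc _ oB _) QA QB (parR s _) with queue-inv QB s
    ... | output e _ QB' = linkAcc accA (oB (on‼ (sym (sh₂-out X)) s)) QA QB'

    linkAcc-in : ∀ {X b A B xs ys b' v P'} → QueueAcc (sh₁ X) b A → QueueAcc (sh₂ X) (b + length xs) B →
                 Queue (sh₁ X) A xs → Queue (sh₂ X) B ys → b ≡ suc b' →
                 par A (pc X ∷ []) B ⇒[ jc X ¿ v ] P' → QueueAcc X b' P'
    linkAcc-in {X} {B = B} {xs} {b' = b'} {v} (qacc _ _ iA) accB QA QB refl (parL s _) with queue-inv QA s
    ... | input _ QA' = linkAcc (iA refl (on¿ (sym (sh₁-in X)) s))
                               (subst (λ k → QueueAcc (sh₂ X) k B) (budget-shift b' xs v) accB) QA' QB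
    linkAcc-in {X} _ _ QA QB _ (parR s _) with queue-inv QB s
    ... | input e _ = ⊥-elim (in≢link X (trans e (sh₂-in X)))

  -- a queue holding x in front of A: once x is output, it becomes a link
  cellAcc : ∀ {X b A xs x} → QueueAcc (sh₁ X) b A → Queue (sh₁ X) A xs →
            QueueAcc (sh₂ X) (b + length xs) (q (sh₂ X)) → QueueAcc X b (holding X A x)
  cellAcc {X} {b} {A} {xs} {x} (qacc τA oA iA) QA accB = qacc cell-τ cell-out cell-in
    where
    cell-τ : ∀ {P'} → holding X A x ⇒[ τ ] P' → QueueAcc X b P'
    cell-τ (parL s _) with queue-inv QA s
    ... | internal QA' = cellAcc (τA s) QA' accB
    cell-τ (commL (here e') _ (sumR pre)) = ⊥-elim (out≢link X e')
    cell-τ (parR (sumR ()) _)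
    cell-τ (commR _ _ (sumR ()))
    cell-out : ∀ {v P'} → holding X A x ⇒[ kc X ‼ v ] P' → QueueAcc X b P'
    cell-out (parL s _) with queue-inv QA s
    ... | output e' _ _ = ⊥-elim (out≢link X (trans e' (sh₁-out X)))
    cell-out (parR (sumR pre) _) = linkAcc (qacc τA oA iA) accB QA empty
    cell-in : ∀ {b' v P'} → b ≡ suc b' → holding X A x ⇒[ jc X ¿ v ] P' → QueueAcc X b' P'
    cell-in {b'} {v} refl (parL s _) with queue-inv QA s
    ... | input _ QA' = cellAcc (iA refl (on¿ (sym (sh₁-in X)) s)) QA'
                               (subst (λ k → QueueAcc (sh₂ X) k (q (sh₂ X))) (budget-shift b' xs v) accB)
    cell-in _ (parR (sumR ()) _)

  empty-no-τ : ∀ {X b P'} → q X ⇒[ τ ] P' → QueueAcc X b P'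
  empty-no-τ s with empty-inv s
  ... | _ , _ , () , _

  empty-no-out : ∀ {X b v P'} → q X ⇒[ kc X ‼ v ] P' → QueueAcc X b P'
  empty-no-out s with empty-inv s
  ... | _ , _ , () , _

  emptyAcc : ∀ b X → QueueAcc X b (q X)
  emptyAcc zero X = qacc empty-no-τ empty-no-out (λ ())
  emptyAcc (suc b) X = qacc empty-no-τ empty-no-out empty-in
    where
    empty-in : ∀ {b' v P'} → suc b ≡ suc b' → q X ⇒[ jc X ¿ v ] P' → QueueAcc X b' P'
    empty-in refl s with empty-inv s
    ... | _ , _ , refl , refl =
      cellAcc (emptyAcc b (sh₁ X)) empty (subst (λ k → QueueAcc _ k _) (sym (+-identityʳ b)) (emptyAcc b (sh₂ X)))

  queueAcc : ∀ {X P cs} → Queue X P cs → ∀ b → QueueAcc X b P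
  queueAcc empty b = emptyAcc b _
  queueAcc (cell _ Q) b = cellAcc (queueAcc Q b) Q (emptyAcc _ _)
  queueAcc (link {xs = xs} QA QB) b = linkAcc (queueAcc QA b) (queueAcc QB (b + length xs)) QA QB

-- What the simulation needs is that
-- normalising is idempotent and commutes, up to normalisation, with the
-- head moves; both are proved via a structural description `trim` of
-- `dropFarBlanks`.
module Tapes (nA n : ℕ) where
  open Calculus nA n

  -- prepend a symbol to a half-tape without creating a far blank
  _∷ᵗ_ : D□ → List D□ → List D□
  just a ∷ᵗ ys = just a ∷ ys
  nothing ∷ᵗ [] = []
  nothing ∷ᵗ (y ∷ ys) = nothing ∷ y ∷ ys

  -- dropFarBlanks, computed from the near end
  trim : List D□ → List D□
  trim [] = []
  trim (x ∷ L) = x ∷ᵗ trim L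

  snocDropped : List D□ → D□ → List D□
  snocDropped [] x = dropWhile isBlank (x ∷ [])
  snocDropped (z ∷ zs) x = z ∷ zs ++ x ∷ []

  dropWhile-snoc : ∀ xs x → dropWhile isBlank (xs ++ x ∷ []) ≡ snocDropped (dropWhile isBlank xs) x
  dropWhile-snoc [] x = refl
  dropWhile-snoc (nothing ∷ ys) x = dropWhile-snoc ys x
  dropWhile-snoc (just a ∷ ys) x = refl

  ∷ᵗ-nonempty : ∀ x ys y → x ∷ᵗ (ys ++ y ∷ []) ≡ x ∷ ys ++ y ∷ []
  ∷ᵗ-nonempty (just a) ys y = refl
  ∷ᵗ-nonempty nothing [] y = refl
  ∷ᵗ-nonempty nothing (z ∷ zs) y = refl

  reverse-snocDropped : ∀ D x → reverse (snocDropped D x) ≡ x ∷ᵗ reverse D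
  reverse-snocDropped [] nothing = refl
  reverse-snocDropped [] (just a) = refl
  reverse-snocDropped (z ∷ zs) x = begin
    reverse (z ∷ zs ++ x ∷ [])     ≡⟨ reverse-++ (z ∷ zs) (x ∷ []) ⟩
    x ∷ reverse (z ∷ zs)           ≡⟨ cong (x ∷_) (unfold-reverse z zs) ⟩
    x ∷ reverse zs ++ z ∷ []       ≡⟨ sym (∷ᵗ-nonempty x (reverse zs) z) ⟩
    x ∷ᵗ (reverse zs ++ z ∷ [])    ≡⟨ cong (x ∷ᵗ_) (sym (unfold-reverse z zs)) ⟩
    x ∷ᵗ reverse (z ∷ zs)          ∎
    where open ≡-Reasoning

  dropFarBlanks-∷ : ∀ x L → dropFarBlanks (x ∷ L) ≡ x ∷ᵗ dropFarBlanks L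
  dropFarBlanks-∷ x L = begin
    reverse (dropWhile isBlank (reverse (x ∷ L)))          ≡⟨ cong (λ r → reverse (dropWhile isBlank r)) (unfold-reverse x L) ⟩
    reverse (dropWhile isBlank (reverse L ++ x ∷ []))      ≡⟨ cong reverse (dropWhile-snoc (reverse L) x) ⟩
    reverse (snocDropped (dropWhile isBlank (reverse L)) x) ≡⟨ reverse-snocDropped (dropWhile isBlank (reverse L)) x ⟩
    x ∷ᵗ dropFarBlanks L                                   ∎
    where open ≡-Reasoning

  dropFarBlanks≡trim : ∀ L → dropFarBlanks L ≡ trim L
  dropFarBlanks≡trim [] = refl
  dropFarBlanks≡trim (x ∷ L) = trans (dropFarBlanks-∷ x L) (cong (x ∷ᵗ_) (dropFarBlanks≡trim L))

  trim-∷ᵗ : ∀ x ys → trim (x ∷ᵗ ys) ≡ x ∷ᵗ trim ys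
  trim-∷ᵗ (just a) ys = refl
  trim-∷ᵗ nothing [] = refl
  trim-∷ᵗ nothing (y ∷ ys) = refl

  trim-idem : ∀ L → trim (trim L) ≡ trim L
  trim-idem [] = refl
  trim-idem (x ∷ L) = trans (trim-∷ᵗ x (trim L)) (cong (x ∷ᵗ_) (trim-idem L))

  trim-fixes-image : ∀ L {ys} → trim L ≡ ys → trim ys ≡ ys
  trim-fixes-image L eq = trans (cong trim (sym eq)) (trans (trim-idem L) eq)

  normᵗ : Tape → Tape
  normᵗ (L , d , R) = (trim L , d , trim R)

  norm≡normᵗ : ∀ t → norm t ≡ normᵗ t
  norm≡normᵗ (L , d , R) = cong₂ (λ L' R' → (L' , d , R')) (dropFarBlanks≡trim L) (dropFarBlanks≡trim R)

  normᵗ-idem : ∀ t → normᵗ (normᵗ t) ≡ normᵗ t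
  normᵗ-idem (L , d , R) = cong₂ (λ L' R' → (L' , d , R')) (trim-idem L) (trim-idem R)

  normᵗ-moveL : ∀ t → normᵗ (moveL (normᵗ t)) ≡ normᵗ (moveL t)
  normᵗ-moveL ([] , d , R) = cong (λ R' → ([] , nothing , d ∷ᵗ R')) (trim-idem R)
  normᵗ-moveL (just a ∷ L , d , R) =
    cong₂ (λ L' R' → (L' , just a , d ∷ᵗ R')) (trim-idem L) (trim-idem R)
  normᵗ-moveL (nothing ∷ L , d , R) with trim L in eq
  ... | [] = cong (λ R' → ([] , nothing , d ∷ᵗ R')) (trim-idem R)
  ... | y ∷ ys = cong₂ (λ L' R' → (L' , nothing , d ∷ᵗ R')) (trim-fixes-image L eq) (trim-idem R)

  normᵗ-moveR : ∀ t → normᵗ (moveR (normᵗ t)) ≡ normᵗ (moveR t)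
  normᵗ-moveR (L , d , []) = cong (λ L' → (d ∷ᵗ L' , nothing , [])) (trim-idem L)
  normᵗ-moveR (L , d , just a ∷ R) =
    cong₂ (λ L' R' → (d ∷ᵗ L' , just a , R')) (trim-idem L) (trim-idem R)
  normᵗ-moveR (L , d , nothing ∷ R) with trim R in eq
  ... | [] = cong (λ L' → (d ∷ᵗ L' , nothing , [])) (trim-idem L)
  ... | y ∷ ys = cong₂ (λ L' R' → (d ∷ᵗ L' , nothing , R')) (trim-idem L) (trim-fixes-image R eq)

  norm-commutes : ∀ (f : Tape → Tape) → (∀ t → normᵗ (f (normᵗ t)) ≡ normᵗ (f t)) →
                  ∀ t → norm (f (norm t)) ≡ norm (f t)
  norm-commutes f normᵗ-f t = begin
    norm (f (norm t))    ≡⟨ norm≡normᵗ (f (norm t)) ⟩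
    normᵗ (f (norm t))   ≡⟨ cong (λ t' → normᵗ (f t')) (norm≡normᵗ t) ⟩
    normᵗ (f (normᵗ t))  ≡⟨ normᵗ-f t ⟩
    normᵗ (f t)          ≡⟨ sym (norm≡normᵗ (f t)) ⟩
    norm (f t)           ∎
    where open ≡-Reasoning

  norm-idem : ∀ t → norm (norm t) ≡ norm t
  norm-idem = norm-commutes (λ t → t) normᵗ-idem

  norm-moveL : ∀ t → norm (moveL (norm t)) ≡ norm (moveL t)
  norm-moveL = norm-commutes moveL normᵗ-moveL

  norm-moveR : ∀ t → norm (moveR (norm t)) ≡ norm (moveR t)
  norm-moveR = norm-commutes moveR normᵗ-moveR

module Commands (nA n : ℕ) where
  open Calculus nA n
  open SumSteps nA n
  open Queues nA n using (_⇒[_]_)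
  open Tapes nA n

  data Cmd (d : D□) : Label → Set where
    read  : Cmd d (cr ‼ dv d)
    write : ∀ e → Cmd d (cw ¿ dv e)
    left  : Cmd d (cm ¿ vL)
    right : Cmd d (cm ¿ vR)

  perform : ∀ {d a} → Cmd d a → Tape → Tape
  perform read t = t
  perform (write e) (L , _ , R) = (L , e , R)
  perform left t = moveL t
  perform right t = moveR t

  next : ∀ {d a} → Cmd d a → HName
  next {d} read = H d
  next (write e) = H e
  next {d} left = HL d
  next {d} right = HR d

  norm-perform : ∀ {d a} (c : Cmd d a) t → norm (perform c (norm t)) ≡ norm (perform c t)
  norm-perform read t = norm-idem t
  norm-perform (write e) (L , _ , R) = norm-idem (L , e , R)
  norm-perform left t = norm-moveL t
  norm-perform right t = norm-moveR t

  -- commands use the channels r, w, m only, so they are not hidden by {i, o}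
  command-visible : ∀ {d a} → Cmd d a → ¬ InI (ci ∷ co ∷ []) a
  command-visible read (inSend (here ()))
  command-visible read (inSend (there (here ())))
  command-visible (write e) (inRecv (here ()))
  command-visible (write e) (inRecv (there (here ())))
  command-visible left (inRecv (here ()))
  command-visible left (inRecv (there (here ())))
  command-visible right (inRecv (here ()))
  command-visible right (inRecv (there (here ())))

  tape-inv : ∀ {L d R a p'} → _⟶[_]_ E∞ (E∞ (L , d , R)) a p' →
             Σ (Cmd d a) λ c → p' ≡ T (perform c (L , d , R))
  tape-inv (sumL pre) = read , refl
  tape-inv {L} {d} {R} (sumR (sumL s)) with Σ𝒟□-inv (λ e → (cw ¿ dv e) ∙ T (L , e , R)) s
  ... | e , pre = write e , refl
  tape-inv (sumR (sumR (sumL pre))) = left , refl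
  tape-inv (sumR (sumR (sumR (sumL pre)))) = right , refl

  tape-does : ∀ {L d R a} (c : Cmd d a) → _⟶[_]_ E∞ (E∞ (L , d , R)) a (T (perform c (L , d , R)))
  tape-does read = sumL pre
  tape-does {L} {d} {R} (write e) = sumR (sumL (Σ𝒟□-intro (λ e → (cw ¿ dv e) ∙ T (L , e , R)) e pre))
  tape-does left = sumR (sumR (sumL pre))
  tape-does right = sumR (sumR (sumR (sumL pre)))

  tape-final : ∀ {t} → _↓ E∞ (E∞ t)
  tape-final = sumR (sumR (sumR (sumR one)))

  H-inv : ∀ {d a c'} → h (H d) ⇒[ a ] c' → Σ (Cmd d a) λ c → c' ≡ h (next c)
  H-inv (rec (sumL pre)) = read , refl
  H-inv (rec (sumR (sumL s))) with Σ𝒟□-inv (λ e → (cw ¿ dv e) ∙ h (H e)) s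
  ... | e , pre = write e , refl
  H-inv (rec (sumR (sumR (sumL pre)))) = left , refl
  H-inv (rec (sumR (sumR (sumR (sumL pre))))) = right , refl

  H-does : ∀ {d a} (c : Cmd d a) → h (H d) ⇒[ a ] h (next c)
  H-does read = rec (sumL pre)
  H-does (write e) = rec (sumR (sumL (Σ𝒟□-intro (λ e → (cw ¿ dv e) ∙ h (H e)) e pre)))
  H-does left = rec (sumR (sumR (sumL pre)))
  H-does right = rec (sumR (sumR (sumR (sumL pre))))

  H-final : ∀ {d} → _↓ ETQ (h (H d))
  H-final = rec (sumR (sumR (sumR (sumR one))))

-- Between two commands the
-- controller is in a `Phase`: either at home in H_d, with the queue holding
-- the encoding `enc t` of the rest of the tape, or in transit, carrying out
-- a head move by rotating the queue.  Every transit phase has a rank that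
-- strictly decreases with each of its steps, and every transit phase can
-- make progress against a queue holding the indicated contents.
module Controller (nA n : ℕ) where
  open Calculus nA n
  open SumSteps nA n
  open Queues nA n using (_⇒[_]_)

  -- the rest of a tape δL ď δR read leftwards from the head, cyclically:
  -- the symbols left of the head nearest first, then the marker s, then the
  -- symbols right of the head farthest first (δL is stored reversed)
  spell : ∀ {A : Set} → (D□ → A) → A → Tape → List A
  spell f s (L , _ , R) = map f L ++ s ∷ map f (reverse R)

  map-reverse-∷ : ∀ {A : Set} (f : D□ → A) e R → map f (reverse (e ∷ R)) ≡ map f (reverse R) ++ f e ∷ []
  map-reverse-∷ f e R = trans (cong (map f) (unfold-reverse e R)) (map-++ f (reverse R) (e ∷ []))

  spell-snoc : ∀ {A : Set} (f : D□ → A) s L d e R →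
               spell f s (L , d , e ∷ R) ≡ spell f s (L , d , R) ++ f e ∷ []
  spell-snoc f s L d e R = begin
    map f L ++ s ∷ map f (reverse (e ∷ R))         ≡⟨ cong (λ r → map f L ++ s ∷ r) (map-reverse-∷ f e R) ⟩
    map f L ++ s ∷ map f (reverse R) ++ f e ∷ []   ≡⟨ sym (++-assoc (map f L) (s ∷ map f (reverse R)) (f e ∷ [])) ⟩
    (map f L ++ s ∷ map f (reverse R)) ++ f e ∷ [] ∎
    where open ≡-Reasoning

  -- the queue contents while the controller is home
  enc : Tape → List Val
  enc = spell dv v⊥

  data Sym : Set where
    sd : D□ → Sym
    s⊥ : Sym

  val : Sym → Val
  val (sd e) = dv e
  val s⊥ = v⊥

  val-Δ : ∀ y → IsΔ (val y)
  val-Δ (sd e) = isD e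
  val-Δ s⊥ = is⊥

  encSym : Tape → List Sym
  encSym = spell sd s⊥

  val-spell : ∀ L R → map val (map sd L ++ s⊥ ∷ map sd R) ≡ map dv L ++ v⊥ ∷ map dv R
  val-spell L R = trans (map-++ val (map sd L) (s⊥ ∷ map sd R))
                        (cong₂ (λ A B → A ++ v⊥ ∷ B) (sym (map-∘ L)) (sym (map-∘ R)))

  ⊥-not-in-half : ∀ pr {rest} (M : List D□) → pr ++ s⊥ ∷ rest ≢ map sd M
  ⊥-not-in-half [] [] ()
  ⊥-not-in-half [] (_ ∷ _) ()
  ⊥-not-in-half (_ ∷ _) [] ()
  ⊥-not-in-half (_ ∷ pr) (_ ∷ M) eq = ⊥-not-in-half pr M (proj₂ (∷-injective eq))

  ⊥-once : ∀ pr {post} L R → pr ++ s⊥ ∷ s⊥ ∷ post ≢ map sd L ++ s⊥ ∷ map sd R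
  ⊥-once [] [] [] ()
  ⊥-once [] [] (_ ∷ _) ()
  ⊥-once [] (_ ∷ _) R ()
  ⊥-once (_ ∷ pr) [] R eq = ⊥-not-in-half pr R (proj₂ (∷-injective eq))
  ⊥-once (_ ∷ pr) (_ ∷ L) R eq = ⊥-once pr L R (proj₂ (∷-injective eq))

  -- waiting for the symbol left of the head, after H^L_d sent d
  Lwait : Proc Name
  Lwait = Σ𝒟□ (λ e → (co ¿ dv e) ∙ h (H e)) ⊕ (co ¿ v⊥) ∙ (ci ‼ v$) ∙ (ci ‼ v⊥) ∙ h Back

  -- waiting for the first symbol of the encoding, after H^R_d sent $ d
  Rwait : Proc Name
  Rwait = Σ𝒟□ (λ e → (co ¿ dv e) ∙ h (Fwd e)) ⊕ (co ¿ v⊥) ∙ h Fwd⊥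

  -- Fwd_e resp. Fwd_⊥: holding a symbol that is still to be forwarded
  forward : Sym → Proc Name
  forward (sd e) = h (Fwd e)
  forward s⊥ = h Fwd⊥

  -- `Transit t c cs`: the controller c is carrying out a head move whose
  -- target tape is t, while the queue holds cs.
  data Transit : Tape → Proc Name → List Val → Set where
    -- moving left from (L0 , d0 , R0): send d0 to the back, then read the
    -- symbol left of the head from the front
    L-start : ∀ {L0 d0 R0} → Transit (moveL (L0 , d0 , R0)) (h (HL d0)) (enc (L0 , d0 , R0))
    L-wait  : ∀ {L0 d0 R0} → Transit (moveL (L0 , d0 , R0)) Lwait (enc (L0 , d0 , R0) ++ dv d0 ∷ [])
    -- ... which was ⊥ (the head was at the left end): write $ ⊥, then copy
    -- the symbols ws before $ to the back, so that ⊥ comes to the front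
    L-mark$ : ∀ {R} → Transit ([] , nothing , R) ((ci ‼ v$) ∙ (ci ‼ v⊥) ∙ h Back) (map dv (reverse R))
    L-mark⊥ : ∀ {R} → Transit ([] , nothing , R) ((ci ‼ v⊥) ∙ h Back) (map dv (reverse R) ++ v$ ∷ [])
    L-back  : ∀ {R us ws} → us ++ ws ≡ reverse R →
              Transit ([] , nothing , R) (h Back) (map dv ws ++ v$ ∷ v⊥ ∷ map dv us)
    L-back' : ∀ {R us e ws} → us ++ e ∷ ws ≡ reverse R →
              Transit ([] , nothing , R) ((ci ‼ dv e) ∙ h Back) (map dv ws ++ v$ ∷ v⊥ ∷ map dv us)
    -- moving right from (L0 , d0 , R0): write $ d0, then forward the
    -- encoding behind them symbol by symbol, keeping back the last one
    R-start : ∀ {L0 d0 R0} → Transit (moveR (L0 , d0 , R0)) (h (HR d0)) (enc (L0 , d0 , R0))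
    R-mark  : ∀ {L0 d0 R0} → Transit (moveR (L0 , d0 , R0)) ((ci ‼ dv d0) ∙ Rwait) (enc (L0 , d0 , R0) ++ v$ ∷ [])
    R-wait  : ∀ {L0 d0 R0} → Transit (moveR (L0 , d0 , R0)) Rwait (enc (L0 , d0 , R0) ++ v$ ∷ dv d0 ∷ [])
    R-fwd   : ∀ {L0 d0 R0 pr held post} → pr ++ held ∷ post ≡ encSym (L0 , d0 , R0) →
              Transit (moveR (L0 , d0 , R0)) (forward held) (map val post ++ v$ ∷ dv d0 ∷ map val pr)
    R-fwd'  : ∀ {L0 d0 R0 pr held y post} → pr ++ held ∷ y ∷ post ≡ encSym (L0 , d0 , R0) →
              Transit (moveR (L0 , d0 , R0)) ((ci ‼ val held) ∙ forward y) (map val post ++ v$ ∷ dv d0 ∷ map val pr)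
    -- the last symbol was ⊥ (the head was at the right end): write it back
    R-end⊥  : ∀ {L0 d0} → Transit (moveR (L0 , d0 , [])) ((ci ‼ v⊥) ∙ h (H nothing)) (dv d0 ∷ map dv L0)

  -- twice; every symbol of the queue costs the controller a read and a write
  dbl : ℕ → ℕ
  dbl zero = zero
  dbl (suc k) = suc (suc (dbl k))

  -- an upper bound on the number of steps until the controller is home
  rank : ∀ {t c cs} → Transit t c cs → ℕ
  rank (L-start {R0 = R0}) = 8 + dbl (length R0)
  rank (L-wait {R0 = R0}) = 7 + dbl (length R0)
  rank (L-mark$ {R}) = 4 + dbl (length R)
  rank (L-mark⊥ {R}) = 2 + dbl (length R)
  rank (L-back {ws = ws} _) = 1 + dbl (length ws)
  rank (L-back' {ws = ws} _) = 2 + dbl (length ws)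
  rank (R-start {L0} {d0} {R0}) = 6 + dbl (length (encSym (L0 , d0 , R0)))
  rank (R-mark {L0} {d0} {R0}) = 4 + dbl (length (encSym (L0 , d0 , R0)))
  rank (R-wait {L0} {d0} {R0}) = 3 + dbl (length (encSym (L0 , d0 , R0)))
  rank (R-fwd {post = post} _) = 3 + dbl (length post)
  rank (R-fwd' {post = post} _) = 4 + dbl (length post)
  rank R-end⊥ = 2

  data Phase : Tape → Proc Name → List Val → Set where
    home    : ∀ {L d R} → Phase (L , d , R) (h (H d)) (enc (L , d , R))
    transit : ∀ {t c cs} → Transit t c cs → Phase t c cs

  rankP : ∀ {t c cs} → Phase t c cs → ℕ
  rankP home = 0
  rankP (transit m) = rank m

  Below : ℕ → Tape → Proc Name → List Val → Set
  Below r t c cs = Σ (Phase t c cs) λ ph → rankP ph < r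

  reindex : ∀ {r t c cs cs'} (ph : Phase t c cs) → rankP ph < r → cs ≡ cs' → Below r t c cs'
  reindex ph lt refl = ph , lt

  below : ∀ k y → y < suc k + y
  below k y = m<n+m y (s≤s z≤n)

  data TransitStep (t : Tape) (cs : List Val) (r : ℕ) : Label → Proc Name → Set where
    reads  : ∀ {v c'} → (∀ {cs'} → cs ≡ v ∷ cs' → Below r t c' cs') → TransitStep t cs r (co ¿ v) c'
    writes : ∀ {v c'} → Below r t c' (cs ++ v ∷ []) → TransitStep t cs r (ci ‼ v) c'

  -- Moving left, the symbol read is the new head, or ⊥ at the left end:
  L-wait-reads-d : ∀ L0 d0 R0 e {cs'} → enc (L0 , d0 , R0) ++ dv d0 ∷ [] ≡ dv e ∷ cs' →
                   Below (7 + dbl (length R0)) (moveL (L0 , d0 , R0)) (h (H e)) cs'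
  L-wait-reads-d [] d0 R0 e ()
  L-wait-reads-d (x ∷ L) d0 R0 e refl = reindex home (s≤s z≤n) (spell-snoc dv v⊥ L x d0 R0)

  L-wait-reads-⊥ : ∀ L0 d0 R0 {cs'} → enc (L0 , d0 , R0) ++ dv d0 ∷ [] ≡ v⊥ ∷ cs' →
                   Below (7 + dbl (length R0)) (moveL (L0 , d0 , R0)) ((ci ‼ v$) ∙ (ci ‼ v⊥) ∙ h Back) cs'
  L-wait-reads-⊥ [] d0 R0 refl = reindex (transit L-mark$) (below 0 _) (map-reverse-∷ dv d0 R0)
  L-wait-reads-⊥ (x ∷ L) d0 R0 ()

  -- rotating ⊥ to the front: copy symbols until $ is read
  L-back-reads-d : ∀ {R} us ws e → us ++ ws ≡ reverse R →
                   ∀ {cs'} → map dv ws ++ v$ ∷ v⊥ ∷ map dv us ≡ dv e ∷ cs' →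
                   Below (1 + dbl (length ws)) ([] , nothing , R) ((ci ‼ dv e) ∙ h Back) cs'
  L-back-reads-d us [] e eq ()
  L-back-reads-d us (w ∷ ws) e eq refl = transit (L-back' eq) , below 0 _

  L-back-reads-$ : ∀ {R} us ws → us ++ ws ≡ reverse R →
                   ∀ {cs'} → map dv ws ++ v$ ∷ v⊥ ∷ map dv us ≡ v$ ∷ cs' →
                   Below (1 + dbl (length ws)) ([] , nothing , R) (h (H nothing)) cs'
  L-back-reads-$ us [] eq refl =
    reindex home (s≤s z≤n) (cong (λ z → v⊥ ∷ map dv z) (sym (trans (sym (++-identityʳ us)) eq)))
  L-back-reads-$ us (w ∷ ws) eq ()

  R-wait-reads-d : ∀ L0 d0 R0 e {cs'} → enc (L0 , d0 , R0) ++ v$ ∷ dv d0 ∷ [] ≡ dv e ∷ cs' →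
                   Below (3 + dbl (length (encSym (L0 , d0 , R0)))) (moveR (L0 , d0 , R0)) (h (Fwd e)) cs'
  R-wait-reads-d [] d0 R0 e ()
  R-wait-reads-d (x ∷ L) d0 R0 e refl =
    reindex (transit (R-fwd {pr = []} {held = sd x} {post = map sd L ++ s⊥ ∷ map sd (reverse R0)} refl))
            (below 1 _) (cong (_++ v$ ∷ dv d0 ∷ []) (val-spell L (reverse R0)))

  R-wait-reads-⊥ : ∀ L0 d0 R0 {cs'} → enc (L0 , d0 , R0) ++ v$ ∷ dv d0 ∷ [] ≡ v⊥ ∷ cs' →
                   Below (3 + dbl (length (encSym (L0 , d0 , R0)))) (moveR (L0 , d0 , R0)) (h Fwd⊥) cs'
  R-wait-reads-⊥ [] d0 R0 refl =
    reindex (transit (R-fwd {pr = []} {held = s⊥} {post = map sd (reverse R0)} refl))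
            (below 1 _) (cong (_++ v$ ∷ dv d0 ∷ []) (sym (map-∘ {g = val} {sd} (reverse R0))))
  R-wait-reads-⊥ (x ∷ L) d0 R0 ()

  R-fwd-reads : ∀ {L0 d0 R0 pr held post} → pr ++ held ∷ post ≡ encSym (L0 , d0 , R0) →
                ∀ y {cs'} → map val post ++ v$ ∷ dv d0 ∷ map val pr ≡ val y ∷ cs' →
                Below (3 + dbl (length post)) (moveR (L0 , d0 , R0)) ((ci ‼ val held) ∙ forward y) cs'
  R-fwd-reads {post = []} eq (sd _) ()
  R-fwd-reads {post = []} eq s⊥ ()
  R-fwd-reads {post = sd _ ∷ _} eq (sd _) refl = transit (R-fwd' eq) , below 0 _
  R-fwd-reads {post = s⊥ ∷ _} eq s⊥ refl = transit (R-fwd' eq) , below 0 _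
  R-fwd-reads {post = sd _ ∷ _} eq s⊥ ()
  R-fwd-reads {post = s⊥ ∷ _} eq (sd _) ()

  -- reading $ while holding the last symbol e of the encoding: e is the new head
  R-fwd-ends-d : ∀ {L0 d0 R0 pr e post} → pr ++ sd e ∷ post ≡ encSym (L0 , d0 , R0) →
                 ∀ {cs'} → map val post ++ v$ ∷ dv d0 ∷ map val pr ≡ v$ ∷ cs' →
                 Below (3 + dbl (length post)) (moveR (L0 , d0 , R0)) (h (H e)) cs'
  R-fwd-ends-d {L0} {d0} {[]} {pr} {post = []} eq refl with ∷ʳ-injective pr (map sd L0) eq
  ... | _ , ()
  R-fwd-ends-d {L0} {d0} {r ∷ R} {pr} {post = []} eq refl
    with ∷ʳ-injective pr (encSym (L0 , d0 , R)) (trans eq (spell-snoc sd s⊥ L0 d0 r R))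
  ... | refl , refl = reindex home (s≤s z≤n) (cong (dv d0 ∷_) (sym (val-spell L0 (reverse R))))
  R-fwd-ends-d {post = sd _ ∷ _} eq ()
  R-fwd-ends-d {post = s⊥ ∷ _} eq ()

  -- reading $ while holding ⊥: the head was at the right end
  R-fwd-ends-⊥ : ∀ {L0 d0 R0 pr post} → pr ++ s⊥ ∷ post ≡ encSym (L0 , d0 , R0) →
                 ∀ {cs'} → map val post ++ v$ ∷ dv d0 ∷ map val pr ≡ v$ ∷ cs' →
                 Below (3 + dbl (length post)) (moveR (L0 , d0 , R0)) ((ci ‼ v⊥) ∙ h (H nothing)) cs'
  R-fwd-ends-⊥ {L0} {d0} {[]} {pr} {post = []} eq refl with ∷ʳ-injective pr (map sd L0) eq
  ... | refl , _ = reindex (transit R-end⊥) (below 0 _) (cong (dv d0 ∷_) (map-∘ {g = val} {sd} L0))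
  R-fwd-ends-⊥ {L0} {d0} {r ∷ R} {pr} {post = []} eq refl
    with ∷ʳ-injective pr (encSym (L0 , d0 , R)) (trans eq (spell-snoc sd s⊥ L0 d0 r R))
  ... | _ , ()
  R-fwd-ends-⊥ {post = sd _ ∷ _} eq ()
  R-fwd-ends-⊥ {post = s⊥ ∷ _} eq ()

  rank-reverse : ∀ (R : List D□) → 1 + dbl (length (reverse R)) < 2 + dbl (length R)
  rank-reverse R = subst (λ k → 1 + dbl k < 2 + dbl (length R)) (sym (length-reverse R)) (below 0 _)

  R-fwd-writes : ∀ d0 pr held post → map val post ++ v$ ∷ dv d0 ∷ map val (pr ++ held ∷ []) ≡
                 (map val post ++ v$ ∷ dv d0 ∷ map val pr) ++ val held ∷ []
  R-fwd-writes d0 pr held post = begin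
    map val post ++ v$ ∷ dv d0 ∷ map val (pr ++ held ∷ [])          ≡⟨ cong (λ z → map val post ++ v$ ∷ dv d0 ∷ z) (map-++ val pr (held ∷ [])) ⟩
    map val post ++ (v$ ∷ dv d0 ∷ map val pr) ++ val held ∷ []     ≡⟨ sym (++-assoc (map val post) (v$ ∷ dv d0 ∷ map val pr) (val held ∷ [])) ⟩
    (map val post ++ v$ ∷ dv d0 ∷ map val pr) ++ val held ∷ []     ∎
    where open ≡-Reasoning

  L-back-writes : ∀ us e ws → map dv ws ++ v$ ∷ v⊥ ∷ map dv (us ++ e ∷ []) ≡
                  (map dv ws ++ v$ ∷ v⊥ ∷ map dv us) ++ dv e ∷ []
  L-back-writes us e ws = begin
    map dv ws ++ v$ ∷ v⊥ ∷ map dv (us ++ e ∷ [])        ≡⟨ cong (λ z → map dv ws ++ v$ ∷ v⊥ ∷ z) (map-++ dv us (e ∷ [])) ⟩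
    map dv ws ++ (v$ ∷ v⊥ ∷ map dv us) ++ dv e ∷ []     ≡⟨ sym (++-assoc (map dv ws) (v$ ∷ v⊥ ∷ map dv us) (dv e ∷ [])) ⟩
    (map dv ws ++ v$ ∷ v⊥ ∷ map dv us) ++ dv e ∷ []     ∎
    where open ≡-Reasoning

  transit-step : ∀ {t c cs a c'} (m : Transit t c cs) → c ⇒[ a ] c' → TransitStep t cs (rank m) a c'
  transit-step L-start (rec pre) = writes (transit L-wait , below 0 _)
  transit-step (L-wait {L0} {d0} {R0}) (sumL s) with Σ𝒟□-inv (λ e → (co ¿ dv e) ∙ h (H e)) s
  ... | e , pre = reads (L-wait-reads-d L0 d0 R0 e)
  transit-step (L-wait {L0} {d0} {R0}) (sumR pre) = reads (L-wait-reads-⊥ L0 d0 R0)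
  transit-step L-mark$ pre = writes (transit L-mark⊥ , below 1 _)
  transit-step (L-mark⊥ {R}) pre =
    writes (reindex (transit (L-back {R} {[]} {reverse R} refl)) (rank-reverse R)
                    (sym (++-assoc (map dv (reverse R)) (v$ ∷ []) (v⊥ ∷ []))))
  transit-step (L-back {us = us} {ws} eq) (rec (sumL s))
    with Σ𝒟□-inv (λ e → (co ¿ dv e) ∙ (ci ‼ dv e) ∙ h Back) s
  ... | e , pre = reads (L-back-reads-d us ws e eq)
  transit-step (L-back {us = us} {ws} eq) (rec (sumR pre)) = reads (L-back-reads-$ us ws eq)
  transit-step (L-back' {us = us} {e} {ws} eq) pre =
    writes (reindex (transit (L-back {us = us ++ e ∷ []} {ws} (trans (++-assoc us (e ∷ []) ws) eq)))
                    (below 0 _) (L-back-writes us e ws))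
  transit-step R-start (rec pre) = writes (transit R-mark , below 1 _)
  transit-step (R-mark {L0} {d0} {R0}) pre =
    writes (reindex (transit R-wait) (below 0 _) (sym (++-assoc (enc (L0 , d0 , R0)) (v$ ∷ []) (dv d0 ∷ []))))
  transit-step (R-wait {L0} {d0} {R0}) (sumL s) with Σ𝒟□-inv (λ e → (co ¿ dv e) ∙ h (Fwd e)) s
  ... | e , pre = reads (R-wait-reads-d L0 d0 R0 e)
  transit-step (R-wait {L0} {d0} {R0}) (sumR pre) = reads (R-wait-reads-⊥ L0 d0 R0)
  transit-step (R-fwd {held = sd e} eq) (rec (sumL s))
    with Σ𝒟□-inv (λ e' → (co ¿ dv e') ∙ (ci ‼ dv e) ∙ h (Fwd e')) s
  ... | e' , pre = reads (R-fwd-reads eq (sd e'))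
  transit-step (R-fwd {held = sd e} eq) (rec (sumR (sumL pre))) = reads (R-fwd-reads eq s⊥)
  transit-step (R-fwd {held = sd e} eq) (rec (sumR (sumR pre))) = reads (R-fwd-ends-d eq)
  transit-step (R-fwd {held = s⊥} eq) (rec (sumL s))
    with Σ𝒟□-inv (λ e → (co ¿ dv e) ∙ (ci ‼ v⊥) ∙ h (Fwd e)) s
  ... | e , pre = reads (R-fwd-reads eq (sd e))
  transit-step (R-fwd {held = s⊥} eq) (rec (sumR pre)) = reads (R-fwd-ends-⊥ eq)
  transit-step (R-fwd' {d0 = d0} {pr = pr} {held} {y} {post} eq) pre =
    writes (reindex (transit (R-fwd {pr = pr ++ held ∷ []} {y} {post} (trans (++-assoc pr (held ∷ []) (y ∷ post)) eq)))
                    (below 0 _) (R-fwd-writes d0 pr held post))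
  transit-step R-end⊥ pre = writes (home , s≤s z≤n)

  data Progress (c : Proc Name) (cs : List Val) : Set where
    can-write : ∀ {v c'} → IsΔ v → c ⇒[ ci ‼ v ] c' → Progress c cs
    can-read  : ∀ {v cs' c'} → cs ≡ v ∷ cs' → c ⇒[ co ¿ v ] c' → Progress c cs

  transit-progress : ∀ {t c cs} → Transit t c cs → Progress c cs
  transit-progress (L-start {d0 = d0}) = can-write (isD d0) (rec pre)
  transit-progress (L-wait {[]}) = can-read refl (sumR pre)
  transit-progress (L-wait {x ∷ L}) = can-read refl (sumL (Σ𝒟□-intro (λ e → (co ¿ dv e) ∙ h (H e)) x pre))
  transit-progress L-mark$ = can-write is$ pre
  transit-progress L-mark⊥ = can-write is⊥ pre
  transit-progress (L-back {ws = []} _) = can-read refl (rec (sumR pre))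
  transit-progress (L-back {ws = w ∷ _} _) =
    can-read refl (rec (sumL (Σ𝒟□-intro (λ e → (co ¿ dv e) ∙ (ci ‼ dv e) ∙ h Back) w pre)))
  transit-progress (L-back' {e = e} _) = can-write (isD e) pre
  transit-progress R-start = can-write is$ (rec pre)
  transit-progress (R-mark {d0 = d0}) = can-write (isD d0) pre
  transit-progress (R-wait {[]}) = can-read refl (sumR pre)
  transit-progress (R-wait {x ∷ L}) = can-read refl (sumL (Σ𝒟□-intro (λ e → (co ¿ dv e) ∙ h (Fwd e)) x pre))
  transit-progress (R-fwd {held = sd e} {[]} _) = can-read refl (rec (sumR (sumR pre)))
  transit-progress (R-fwd {held = sd e} {sd e' ∷ _} _) =
    can-read refl (rec (sumL (Σ𝒟□-intro (λ e' → (co ¿ dv e') ∙ (ci ‼ dv e) ∙ h (Fwd e')) e' pre)))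
  transit-progress (R-fwd {held = sd e} {s⊥ ∷ _} _) = can-read refl (rec (sumR (sumL pre)))
  transit-progress (R-fwd {held = s⊥} {[]} _) = can-read refl (rec (sumR pre))
  transit-progress (R-fwd {held = s⊥} {sd e ∷ _} _) =
    can-read refl (rec (sumL (Σ𝒟□-intro (λ e → (co ¿ dv e) ∙ (ci ‼ v⊥) ∙ h (Fwd e)) e pre)))
  transit-progress (R-fwd {L0} {d0} {R0} {pr} {s⊥} {s⊥ ∷ _} eq) = ⊥-elim (⊥-once pr L0 (reverse R0) eq)
  transit-progress (R-fwd' {held = held} _) = can-write (val-Δ held) pre
  transit-progress R-end⊥ = can-write is⊥ pre

module Simulation (nA n : ℕ) where
  open Calculus nA n
  open SumSteps nA n using (is⊥)
  open Runs nA n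
  open Queues nA n
  open Tapes nA n
  open Commands nA n
  open Controller nA n

  IO : List Chan
  IO = ci ∷ co ∷ []

  data Sim : Proc Tape → Proc Name → Set where
    sim : ∀ {t c Q cs} → Phase t c cs → Queue Qiol Q cs → Sim (T t) (par c IO Q)

  headOf : Tape → D□
  headOf (_ , d , _) = d

  go-home : ∀ k {t c Q cs} (ph : Phase t c cs) → rankP ph < k → Queue Qiol Q cs →
            Σ (Proc Name) λ Q' → (par c IO Q ⇒τ* par (h (H (headOf t))) IO Q') × Queue Qiol Q' (enc t)
  go-home (suc k) home _ Qq = _ , ε , Qq
  go-home (suc k) (transit m) lt Qq with transit-progress m
  ... | can-write iv s with transit-step m s | queue-input Qq iv
  ...   | writes (ph' , lt') | _ , sQ , Qq' with go-home k ph' (<-≤-trans lt' (s≤s⁻¹ lt)) Qq'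
  ...     | Q'' , run , Qq'' = Q'' , commR (here refl) s sQ ◅ run , Qq''
  go-home (suc k) (transit m) lt Qq | can-read eq s with transit-step m s
  ... | reads next with next eq | queue-output Qq eq
  ...   | ph' , lt' | _ , _ , τQ , oQ , Qq' , _ with go-home k ph' (<-≤-trans lt' (s≤s⁻¹ lt)) Qq'
  ...     | Q'' , run , Qq'' =
    Q'' , run-right τQ ◅◅ commL (there (here refl)) s oQ ◅ run , Qq''

  data τ-Successor {t c cs} (ph : Phase t c cs) (Q : Proc Name) : Proc Name → Set where
    in-queue : ∀ {Q'} → Q ⇒[ τ ] Q' → Queue Qiol Q' cs → τ-Successor ph Q (par c IO Q')
    advance  : ∀ {c' cs' Q'} (ph' : Phase t c' cs') → rankP ph' < rankP ph → Queue Qiol Q' cs' →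
               τ-Successor ph Q (par c' IO Q')

  system-τ : ∀ {t c Q cs} (ph : Phase t c cs) → Queue Qiol Q cs →
             ∀ {S} → par c IO Q ⇒[ τ ] S → τ-Successor ph Q S
  system-τ home Qq (parL sc _) with H-inv sc
  ... | () , _
  system-τ (transit m) Qq (parL sc _) with transit-step m sc
  ... | ()
  system-τ ph Qq (parR sq _) with queue-inv Qq sq
  ... | internal Qq' = in-queue sq Qq'
  system-τ home Qq (commL m sc _) with H-inv sc
  ... | cmd , _ = ⊥-elim (command-visible cmd (inRecv m))
  system-τ (transit m) Qq (commL _ sc sq) with transit-step m sc | queue-inv Qq sq
  ... | reads next | output _ eq Qq' with next eq
  ...   | ph' , lt' = advance ph' lt' Qq'
  system-τ home Qq (commR m sc _) with H-inv sc
  ... | cmd , _ = ⊥-elim (command-visible cmd (inSend m))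
  system-τ (transit m) Qq (commR _ sc sq) with transit-step m sc | queue-inv Qq sq
  ... | writes (ph' , lt') | input _ Qq' = advance ph' lt' Qq'

  stays : ∀ {t c Q cs S} {ph : Phase t c cs} → τ-Successor ph Q S → Sim (T t) S
  stays {ph = ph} (in-queue _ Qq') = sim ph Qq'
  stays (advance ph' _ Qq') = sim ph' Qq'

  -- hence every τ-run of a simulating system is finite: lexicographic
  -- induction on the rank bound and on the accessibility of the queue
  mutual
    terminates : ∀ k {t c Q cs} (ph : Phase t c cs) → rankP ph < k → Queue Qiol Q cs →
                 QueueAcc Qiol 0 Q → Acc (_⇐τ_ ETQ) (par c IO Q)
    terminates k ph lt Qq qa = acc λ s → successor-terminates k ph lt qa (system-τ ph Qq s)

    successor-terminates : ∀ k {t c Q cs S} (ph : Phase t c cs) → rankP ph < k → QueueAcc Qiol 0 Q →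
                           τ-Successor ph Q S → Acc (_⇐τ_ ETQ) S
    successor-terminates k ph lt (qacc τQ _ _) (in-queue sq Qq') = terminates k ph lt Qq' (τQ sq)
    successor-terminates (suc k) ph lt _ (advance ph' lt' Qq') =
      terminates k ph' (<-≤-trans lt' (s≤s⁻¹ lt)) Qq' (queueAcc Qq' 0)

  command-phase : ∀ {L d R a} (c : Cmd d a) → Phase (perform c (L , d , R)) (h (next c)) (enc (L , d , R))
  command-phase read = home
  command-phase (write e) = home
  command-phase left = transit L-start
  command-phase right = transit R-start

  after-command : ∀ {L d R a Q} (c : Cmd d a) → Queue Qiol Q (enc (L , d , R)) →
                  Sim (T (perform c (norm (L , d , R)))) (par (h (next c)) IO Q)
  after-command {L} {d} {R} c Qq =
    subst (λ t → Sim (var t) _) (sym (norm-perform c (L , d , R))) (sim (command-phase c) Qq)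

  Tape-LTS System-LTS : LTS Label
  Tape-LTS = 𝒯 E∞ T□
  System-LTS = 𝒯 ETQ System

  Related : LTS.State Tape-LTS → LTS.State System-LTS → Set
  Related (p₁ , _) (p₂ , _) = Sim p₁ p₂

  return-home : ∀ {L d R c Q cs} → Phase (L , d , R) c cs → Queue Qiol Q cs →
                (r : Reach ETQ System (par c IO Q)) →
                Σ (Proc Name) λ Q' → Σ (Reach ETQ System (par (h (H d)) IO Q')) λ r' →
                  _↠_ System-LTS (par c IO Q , r) (par (h (H d)) IO Q' , r') × Queue Qiol Q' (enc (L , d , R))
  return-home ph Qq r with go-home _ ph (n<1+n _) Qq
  ... | Q' , run , Qq' with lift-run ETQ run r
  ...   | r' , run' = Q' , r' , run' , Qq'

  -- a tape step is matched by returning home and issuing the same command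
  tape-step : ∀ {s₁ s₂} → Related s₁ s₂ → ∀ {a s₁'} → LTS._⟶[_]_ Tape-LTS s₁ a s₁' →
              Σ (LTS.State System-LTS) λ s₂'' → Σ (LTS.State System-LTS) λ s₂' →
                _↠_ System-LTS s₂ s₂'' × _⟶⟨_⟩_ System-LTS s₂'' a s₂' × Related s₁ s₂'' × Related s₁' s₂'
  tape-step {s₂ = _ , r₂} (sim {t = L , d , R} ph Qq) {s₁' = _ , _} (rec s)
    with tape-inv {dropFarBlanks L} {d} {dropFarBlanks R} s | return-home ph Qq r₂
  ... | cmd , refl | Q' , r' , run , Qq' =
    (_ , r') , (_ , there r' step) , run , inj₁ step , sim (home {L} {d} {R}) Qq' , after-command {L} {d} {R} cmd Qq'
    where step = parL (H-does cmd) (command-visible cmd)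

  tape-final-matched : ∀ {s₁ s₂} → Related s₁ s₂ → LTS.Final Tape-LTS s₁ →
                       Σ (LTS.State System-LTS) λ s₂' → _↠_ System-LTS s₂ s₂' × LTS.Final System-LTS s₂' × Related s₁ s₂'
  tape-final-matched {s₂ = _ , r₂} (sim {t = L , d , R} ph Qq) _ with return-home ph Qq r₂
  ... | Q' , r' , run , Qq' = (_ , r') , run , par↓ H-final (queue-final Qq') , sim (home {L} {d} {R}) Qq'

  -- a related tape has no τ-steps, a related system no infinite τ-run
  tape-no-τ : ∀ {p₁ p₂ p'} → Sim p₁ p₂ → ¬ _⟶[_]_ E∞ p₁ τ p'
  tape-no-τ (sim {t = L , d , R} _ _) (rec s) with tape-inv {dropFarBlanks L} {d} {dropFarBlanks R} s
  ... | () , _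

  system-terminates : ∀ {p₁ p₂} → Sim p₁ p₂ → Acc (_⇐τ_ ETQ) p₂
  system-terminates (sim ph Qq) = terminates _ ph (n<1+n _) Qq (queueAcc Qq 0)

  tape-divergence : ∀ {s₁ s₂} → Related s₁ s₂ → (f : ℕ → LTS.State Tape-LTS) → f 0 ≡ s₁ →
                    (∀ k → LTS._⟶[_]_ Tape-LTS (f k) τ (f (suc k))) → (∀ k → Related (f k) s₂) →
                    Σ (LTS.State System-LTS) λ s₂' → _↠⁺_ System-LTS s₂ s₂' × Σ ℕ λ k → Related (f k) s₂'
  tape-divergence _ f _ run related = ⊥-elim (tape-no-τ (related 0) (run 0))

  idle : ∀ {s₁} s₂ s₂' → Related s₁ s₂ → Related s₁ s₂' →
         Σ (LTS.State Tape-LTS) λ s₁'' → Σ (LTS.State Tape-LTS) λ s₁' →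
           _↠_ Tape-LTS s₁ s₁'' × _⟶⟨_⟩_ Tape-LTS s₁'' τ s₁' × Related s₁'' s₂ × Related s₁' s₂'
  idle {s₁} _ _ before after = s₁ , s₁ , ↠refl , inj₂ (refl , refl) , before , after

  -- a system step is a command at home, matched by the tape, or a τ-step
  -- that keeps the system related to the same tape
  system-step : ∀ {s₂ s₁} → Related s₁ s₂ → ∀ {a s₂'} → LTS._⟶[_]_ System-LTS s₂ a s₂' →
                Σ (LTS.State Tape-LTS) λ s₁'' → Σ (LTS.State Tape-LTS) λ s₁' →
                  _↠_ Tape-LTS s₁ s₁'' × _⟶⟨_⟩_ Tape-LTS s₁'' a s₁' × Related s₁'' s₂ × Related s₁' s₂'
  system-step {s₁ = s₁} (sim {t = L , d , R} home Qq) (parL sc _) with H-inv sc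
  ... | cmd , refl =
    s₁ , (_ , there (proj₂ s₁) step) , ↠refl , inj₁ step ,
    sim (home {L} {d} {R}) Qq , after-command {L} {d} {R} cmd Qq
    where step = rec (tape-does {dropFarBlanks L} {d} {dropFarBlanks R} cmd)
  system-step (sim (transit m) Qq) (parL sc ∉I) with transit-step m sc
  ... | reads _ = ⊥-elim (∉I (inRecv (there (here refl))))
  ... | writes _ = ⊥-elim (∉I (inSend (here refl)))
  system-step {s₂} (sim ph Qq) {s₂' = s₂'} (parR sq ∉I) with queue-inv Qq sq
  ... | input e _ = ⊥-elim (∉I (inRecv (here e)))
  ... | output e _ _ = ⊥-elim (∉I (inSend (there (here e))))
  ... | internal Qq' = idle s₂ s₂' (sim ph Qq) (sim ph Qq')
  system-step {s₂} (sim ph Qq) {s₂' = s₂'} s@(commL _ _ _) = idle s₂ s₂' (sim ph Qq) (stays (system-τ ph Qq s))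
  system-step {s₂} (sim ph Qq) {s₂' = s₂'} s@(commR _ _ _) = idle s₂ s₂' (sim ph Qq) (stays (system-τ ph Qq s))

  -- every tape state is final
  system-final-matched : ∀ {s₂ s₁} → Related s₁ s₂ → LTS.Final System-LTS s₂ →
                         Σ (LTS.State Tape-LTS) λ s₁' → _↠_ Tape-LTS s₁ s₁' × LTS.Final Tape-LTS s₁' × Related s₁' s₂
  system-final-matched {s₁ = s₁} related@(sim {t = t} _ _) _ = s₁ , ↠refl , rec (tape-final {norm t}) , related

  system-divergence : ∀ {s₂ s₁} → Related s₁ s₂ → (f : ℕ → LTS.State System-LTS) → f 0 ≡ s₂ →
                      (∀ k → LTS._⟶[_]_ System-LTS (f k) τ (f (suc k))) → (∀ k → Related s₁ (f k)) →
                      Σ (LTS.State Tape-LTS) λ s₁' → _↠⁺_ Tape-LTS s₁ s₁' × Σ ℕ λ k → Related s₁' (f k)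
  system-divergence _ f _ run related =
    ⊥-elim (no-infinite-run ETQ (system-terminates (related 0)) (λ i → proj₁ (f i)) refl run)

  simulation : IsDivBranchingBisim Tape-LTS System-LTS Related
  simulation = record
    { forth = record { step       = λ {s₁} {s₂} → tape-step {s₁} {s₂}
                     ; final      = λ {s₁} {s₂} → tape-final-matched {s₁} {s₂}
                     ; divergence = λ {s₁} {s₂} → tape-divergence {s₁} {s₂} }
    ; back  = record { step       = λ {s₂} {s₁} → system-step {s₂} {s₁}
                     ; final      = λ {s₂} {s₁} → system-final-matched {s₂} {s₁}
                     ; divergence = λ {s₂} {s₁} → system-divergence {s₂} {s₁} } }

  -- initially the controller is home at the blank and the queue holds ⊥
  initial : Sim T□ System
  initial = sim (home {[]} {nothing} {[]}) (cell is⊥ empty)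

corollary5 : (nA n : ℕ) → let open Calculus nA n in
    𝒯 E∞ T□ ↔bΔ 𝒯 ETQ System
corollary5 nA n = Related , simulation , initial
  where open Simulation nA n
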